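{- Let $\mathcal{A}=\{0,\ldots,n-1\}$ for some $n\in\mathbb{N}$ and let $l:\mathcal{A}\rightarrow\mathbb{N}$ satisfy $$\sum_{i\in\mathcal{A},\ l(i)\neq 0}2^{ -l(i)}\le 1.$$ Then there is a Deflate coding $\lceil\cdot\rceil:\mathcal{A}\rightarrow\{0,1\}^*$ such that $l(x)=\operatorname{len}\lceil x\rceil$ for all $x\in\mathcal{A}$.
   Context: $\{0,1\}^*$ is the set of finite bit lists, $[\,]$ is the empty list, $::$ is cons, $+\!\!+$ is concatenation, $\{0,1\}^+$ is the set of nonempty bit lists. For bit lists $a,b$, write $a\preccurlyeq b$ ($a$ is a prefix of $b$) if there is $c\in\{0,1\}^*$ with $a+\!\!+c=b$. The lexicographical ordering $\sqsubseteq$ on $\{0,1\}^*$ is the least relation with $[\,]\sqsubseteq a$ for all $a$; $0::a\sqsubseteq 1::b$ for all $a,b$; and $j::a\sqsubseteq j::b$ whenever $a\sqsubseteq b$ (for $j\in\{0,1\}$). A Deflate coding is a map $\lceil\cdot\rceil:\mathcal{A}\to\{0,1\}^*$ such that: (1) for all $a\neq b$ with $\lceil a\rceil\neq[\,]$, $\lceil a\rceil\not\preccurlyeq\lceil b\rceil$; (2) for all $a,b$, if $\operatorname{len}\lceil a\rceil<\operatorname{len}\lceil b\rceil$ then $\lceil a\rceil\sqsubseteq\lceil b\rceil$; (3) for all $a,b$, if $\operatorname{len}\lceil a\rceil=\operatorname{len}\lceil b\rceil$ and $a\le b$ then $\lceil a\rceil\sqsubseteq\lceil b\rceil$; (4)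 for all $a\in\mathcal{A}$ and $l\in\{0,1\}^+$, if $l\sqsubseteq\lceil a\rceil$ and $\operatorname{len} l=\operatorname{len}\lceil a\rceil$, then there exists $b\in\mathcal{A}$ with $\lceil b\rceil\neq[\,]$ and $\lceil b\rceil\preccurlyeq l$. -}

module Defs where

open import Data.Bool using (Bool; true; false)
open import Data.Nat as ℕ using (ℕ; zero; suc; _^_)
open import Data.Nat.Properties using (m^n≢0)
open import Data.Fin as Fin using (Fin)
open import Data.List using (List; []; _∷_; _++_; length; sum; map; filter)
open import Data.List using (allFin)
open import Data.Product using (Σ; ∃; _×_; _,_)
open import Data.Integer using (+_)
open import Data.Rational as ℚ using (ℚ)
open import Relation.Binary.PropositionalEquality using (_≡_; _≢_)
open import Relation.Nullary using (¬_; ¬?)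
open import Data.List using (foldr)

-- Bits: false = 0, true = 1.
Bit : Set
Bit = Bool

_≼_ : List Bit → List Bit → Set
a ≼ b = ∃ λ c → a ++ c ≡ b

data _⊑_ : List Bit → List Bit → Set where
  []⊑   : ∀ {a} → [] ⊑ a
  0⊑1   : ∀ {a b} → (false ∷ a) ⊑ (true ∷ b)
  cons⊑ : ∀ {j a b} → a ⊑ b → (j ∷ a) ⊑ (j ∷ b)

record IsDeflateCoding {n : ℕ} (code : Fin n → List Bit) : Set where
  field
    prefixFree : ∀ a b → a ≢ b → code a ≢ [] → ¬ (code a ≼ code b)
    shorterFirst : ∀ a b → length (code a) ℕ.< length (code b) → code a ⊑ code b
    sameLenOrdered : ∀ a b → length (code a) ≡ length (code b) → a Fin.≤ b → code a ⊑ code b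
    noGaps : ∀ a (l : List Bit) → l ≢ [] → l ⊑ code a → length l ≡ length (code a) →
             ∃ λ b → (code b ≢ []) × (code b ≼ l)

2^-_ : ℕ → ℚ
2^- k = (+ 1) ℚ./ (2 ^ k)
  where instance _ = m^n≢0 2 k

kraftSum : ∀ {n} → (Fin n → ℕ) → ℚ
kraftSum {n} l = foldr ℚ._+_ ℚ.0ℚ (map (λ i → 2^- l i) (filter (λ i → ¬? (l i ℕ.≟ 0)) (allFin n)))

-- Fix a width M bounding all lengths and read a bit list u (|u| ≤ M) as the
-- block of M-digit binary numerals having u as leading digits, an interval of
-- length 2^(M ∸ |u|) starting at the value of u: u is a prefix of w iff the value of w lies in the block of u, and for
-- |u| ≤ |w| the lexicographic order u ⊑ w is the numeric order of the values.
-- Lay out blocks of size 2^(M ∸ l a) for the used symbols one after another,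
-- ordered by length and then by index. The Kraft inequality says they fit into
-- [0, 2^M), and each block starts at a multiple of its size, so it is the block
-- of a unique codeword of length l a. Disjointness of the blocks gives
-- prefix-freeness, their order gives the two ordering conditions, and the
-- fact that they tile an initial segment of ℕ gives the no-gaps condition.

module Submission where

open import Data.Bool using (true; false)
open import Data.Empty using (⊥-elim)
open import Data.List using (List; []; _∷_; _++_; length; foldr; map; filter; tabulate)
open import Data.List.Properties using (++-conicalˡ; filter-accept; filter-reject)
open import Data.Nat as ℕ using (ℕ; zero; suc; _+_; _*_; _∸_; _^_; _≤_; _<_; z≤n; s≤s; z<s; s≤s⁻¹)
open import Data.Nat.Divisibility using (_∣_; divides; ∣⇒≤; ∣m+n∣m⇒∣n; ∣m∣n⇒∣m+n; _∣0)
open import Data.Nat.Properties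
open import Data.Fin as Fin using (Fin; zero; suc; toℕ)
import Data.Fin.Properties as Finₚ
open import Data.Vec.Functional using (replicate)
open import Algebra.Properties.CommutativeMonoid.Sum +-0-commutativeMonoid
  using (sum; sum-cong-≗; sum-replicate-zero; ∑-distrib-+)
open import Data.Product using (Σ; ∃; _×_; _,_)
open import Data.Sum using (inj₁; inj₂)
open import Function using (_∘_; id)
open import Agda.Builtin.Int using (pos)
import Data.Integer as ℤ using (_+_; _*_; _≤_)
import Data.Integer.Properties as ℤ
open import Data.Rational as ℚ using (ℚ; 0ℚ; 1ℚ; toℚᵘ)
import Data.Rational.Properties as ℚ
open import Data.Rational.Unnormalised as ℚᵘ using (ℚᵘ; mkℚᵘ; *≡*; *≤*) renaming (_≃_ to _≃ᵘ_)
import Data.Rational.Unnormalised.Properties as ℚᵘ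
open import Relation.Binary.PropositionalEquality
open import Relation.Nullary using (¬_; ¬?; yes; no)
open import Relation.Binary.Definitions using (tri<; tri≈; tri>)
open import Defs

^-monoʳ-∣ : ∀ m {i j} → i ≤ j → m ^ i ∣ m ^ j
^-monoʳ-∣ m {i} {j} i≤j = divides (m ^ (j ∸ i))
  (trans (cong (m ^_) (sym (m∸n+n≡m i≤j))) (^-distribˡ-+-* m (j ∸ i) i))

2^[1+m]≡2^m+2^m : ∀ m → 2 ^ suc m ≡ 2 ^ m + 2 ^ m
2^[1+m]≡2^m+2^m m = cong (2 ^ m +_) (+-identityʳ (2 ^ m))

_∈[_,_⟩ : ℕ → ℕ → ℕ → Set
v ∈[ a , b ⟩ = a ≤ v × v < b

∈[s,s+x⟩⇒0<x : ∀ {v s x} → v ∈[ s , s + x ⟩ → 0 < x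
∈[s,s+x⟩⇒0<x {v} {s} {x} (s≤v , v<s+x) =
  +-cancelˡ-< s 0 x (≤-<-trans (≤-reflexive (+-identityʳ s)) (≤-<-trans s≤v v<s+x))

-- value m u reads u as the leading digits of an m-digit binary numeral, i.e. u
-- padded with zeros to length m (digits beyond the m-th are ignored), and
-- leadingBits k m x is the list of the first k digits of x as an m-digit numeral.
value : ℕ → List Bit → ℕ
value m [] = 0
value zero (_ ∷ _) = 0
value (suc m) (true ∷ u) = 2 ^ m + value m u
value (suc m) (false ∷ u) = value m u

leadingBits : ℕ → ℕ → ℕ → List Bit
leadingBits zero m x = []
leadingBits (suc k) zero x = false ∷ leadingBits k zero x
leadingBits (suc k) (suc m) x with 2 ^ m ≤? x
... | yes _ = true ∷ leadingBits k m (x ∸ 2 ^ m)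
... | no _ = false ∷ leadingBits k m x

length-leadingBits : ∀ k m x → length (leadingBits k m x) ≡ k
length-leadingBits zero m x = refl
length-leadingBits (suc k) zero x = cong suc (length-leadingBits k zero x)
length-leadingBits (suc k) (suc m) x with 2 ^ m ≤? x
... | yes _ = cong suc (length-leadingBits k m (x ∸ 2 ^ m))
... | no _ = cong suc (length-leadingBits k m x)

value-leadingBits : ∀ k m x → k ≤ m → x < 2 ^ m → 2 ^ (m ∸ k) ∣ x →
                    value m (leadingBits k m x) ≡ x
value-leadingBits zero m zero _ _ _ = refl
value-leadingBits zero m (suc x) _ x<2^m 2^m∣x = ⊥-elim (<⇒≱ x<2^m (∣⇒≤ 2^m∣x))
value-leadingBits (suc k) (suc m) x (s≤s k≤m) x<2^m 2^[m∸k]∣x with 2 ^ m ≤? x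
... | no 2^m≰x = value-leadingBits k m x k≤m (≰⇒> 2^m≰x) 2^[m∸k]∣x
... | yes 2^m≤x = trans (cong (2 ^ m +_) (value-leadingBits k m (x ∸ 2 ^ m) k≤m x∸2^m<2^m divides-rest))
                        (m+[n∸m]≡n 2^m≤x)
  where
  x∸2^m<2^m : x ∸ 2 ^ m < 2 ^ m
  x∸2^m<2^m = m<n+o⇒m∸n<o x (2 ^ m) {{m^n≢0 2 m}} (subst (x <_) (2^[1+m]≡2^m+2^m m) x<2^m)
  divides-rest : 2 ^ (m ∸ k) ∣ x ∸ 2 ^ m
  divides-rest = ∣m+n∣m⇒∣n (subst (2 ^ (m ∸ k) ∣_) (sym (m+[n∸m]≡n 2^m≤x)) 2^[m∸k]∣x)
                           (^-monoʳ-∣ 2 (m∸n≤m m k))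

value+2^[m∸len]≤2^m : ∀ m u → length u ≤ m → value m u + 2 ^ (m ∸ length u) ≤ 2 ^ m
value+2^[m∸len]≤2^m m [] _ = ≤-refl
value+2^[m∸len]≤2^m (suc m) (true ∷ u) (s≤s |u|≤m) = begin
  2 ^ m + value m u + 2 ^ (m ∸ length u)   ≡⟨ +-assoc (2 ^ m) _ _ ⟩
  2 ^ m + (value m u + 2 ^ (m ∸ length u)) ≤⟨ +-monoʳ-≤ (2 ^ m) (value+2^[m∸len]≤2^m m u |u|≤m) ⟩
  2 ^ m + 2 ^ m                            ≡⟨ 2^[1+m]≡2^m+2^m m ⟨
  2 ^ suc m                                ∎
  where open ≤-Reasoning
value+2^[m∸len]≤2^m (suc m) (false ∷ u) (s≤s |u|≤m) = begin
  value m u + 2 ^ (m ∸ length u) ≤⟨ value+2^[m∸len]≤2^m m u |u|≤m ⟩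
  2 ^ m                          ≤⟨ m≤m+n (2 ^ m) (2 ^ m) ⟩
  2 ^ m + 2 ^ m                  ≡⟨ 2^[1+m]≡2^m+2^m m ⟨
  2 ^ suc m                      ∎
  where open ≤-Reasoning

value<2^m : ∀ m u → length u ≤ m → value m u < 2 ^ m
value<2^m m u |u|≤m = <-≤-trans (m<m+n (value m u) (m^n>0 2 (m ∸ length u)))
                                (value+2^[m∸len]≤2^m m u |u|≤m)

value-≤⇒⊑ : ∀ m u w → length u ≤ length w → length w ≤ m → value m u ≤ value m w → u ⊑ w
value-≤⇒⊑ m [] w _ _ _ = []⊑
value-≤⇒⊑ (suc m) (false ∷ u) (true ∷ w) _ _ _ = 0⊑1
value-≤⇒⊑ (suc m) (true ∷ u) (false ∷ w) _ (s≤s |w|≤m) u≤w =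
  ⊥-elim (<⇒≱ (value<2^m m w |w|≤m) (≤-trans (m≤m+n (2 ^ m) (value m u)) u≤w))
value-≤⇒⊑ (suc m) (true ∷ u) (true ∷ w) (s≤s |u|≤|w|) (s≤s |w|≤m) u≤w =
  cons⊑ (value-≤⇒⊑ m u w |u|≤|w| |w|≤m (+-cancelˡ-≤ (2 ^ m) _ _ u≤w))
value-≤⇒⊑ (suc m) (false ∷ u) (false ∷ w) (s≤s |u|≤|w|) (s≤s |w|≤m) u≤w =
  cons⊑ (value-≤⇒⊑ m u w |u|≤|w| |w|≤m u≤w)

⊑⇒value-≤ : ∀ m u w → u ⊑ w → length u ≤ m → length w ≤ m → value m u ≤ value m w
⊑⇒value-≤ m [] w []⊑ _ _ = z≤n
⊑⇒value-≤ (suc m) (false ∷ u) (true ∷ w) 0⊑1 (s≤s |u|≤m) _ =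
  ≤-trans (<⇒≤ (value<2^m m u |u|≤m)) (m≤m+n (2 ^ m) (value m w))
⊑⇒value-≤ (suc m) (false ∷ u) (false ∷ w) (cons⊑ u⊑w) (s≤s |u|≤m) (s≤s |w|≤m) =
  ⊑⇒value-≤ m u w u⊑w |u|≤m |w|≤m
⊑⇒value-≤ (suc m) (true ∷ u) (true ∷ w) (cons⊑ u⊑w) (s≤s |u|≤m) (s≤s |w|≤m) =
  +-monoʳ-≤ (2 ^ m) (⊑⇒value-≤ m u w u⊑w |u|≤m |w|≤m)

≼⇒value-∈ : ∀ m u w → u ≼ w → length w ≤ m →
            value m w ∈[ value m u , value m u + 2 ^ (m ∸ length u) ⟩
≼⇒value-∈ m u _ (c , refl) = go m u c
  where
  go : ∀ m u c → length (u ++ c) ≤ m →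
       value m (u ++ c) ∈[ value m u , value m u + 2 ^ (m ∸ length u) ⟩
  go m [] c |c|≤m = z≤n , value<2^m m c |c|≤m
  go (suc m) (false ∷ u) c (s≤s |uc|≤m) = go m u c |uc|≤m
  go (suc m) (true ∷ u) c (s≤s |uc|≤m) with go m u c |uc|≤m
  ... | lower , upper = +-monoʳ-≤ (2 ^ m) lower
                      , subst (2 ^ m + value m (u ++ c) <_) (sym (+-assoc (2 ^ m) _ _)) (+-monoʳ-< (2 ^ m) upper)

value-∈⇒≼ : ∀ m u w → length u ≤ length w → length w ≤ m →
            value m w ∈[ value m u , value m u + 2 ^ (m ∸ length u) ⟩ → u ≼ w
value-∈⇒≼ m [] w _ _ _ = w , refl
value-∈⇒≼ (suc m) (true ∷ u) (false ∷ w) _ (s≤s |w|≤m) (lower , _) =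
  ⊥-elim (<⇒≱ (value<2^m m w |w|≤m) (≤-trans (m≤m+n (2 ^ m) (value m u)) lower))
value-∈⇒≼ (suc m) (false ∷ u) (true ∷ w) (s≤s |u|≤|w|) (s≤s |w|≤m) (_ , upper) =
  ⊥-elim (<⇒≱ (<-≤-trans upper (value+2^[m∸len]≤2^m m u (≤-trans |u|≤|w| |w|≤m)))
              (m≤m+n (2 ^ m) (value m w)))
value-∈⇒≼ (suc m) (true ∷ u) (true ∷ w) (s≤s |u|≤|w|) (s≤s |w|≤m) (lower , upper)
  with value-∈⇒≼ m u w |u|≤|w| |w|≤m
         (+-cancelˡ-≤ (2 ^ m) _ _ lower , +-cancelˡ-< (2 ^ m) _ _ (subst (2 ^ m + value m w <_) (+-assoc (2 ^ m) _ _) upper))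
... | c , u++c≡w = c , cong (true ∷_) u++c≡w
value-∈⇒≼ (suc m) (false ∷ u) (false ∷ w) (s≤s |u|≤|w|) (s≤s |w|≤m) w∈
  with value-∈⇒≼ m u w |u|≤|w| |w|≤m w∈
... | c , u++c≡w = c , cong (false ∷_) u++c≡w

sum-mono-≤ : ∀ {k} {f g : Fin k → ℕ} → (∀ i → f i ≤ g i) → sum f ≤ sum g
sum-mono-≤ {zero} _ = z≤n
sum-mono-≤ {suc k} f≤g = +-mono-≤ (f≤g zero) (sum-mono-≤ (f≤g ∘ suc))

term≤sum : ∀ {k} (f : Fin k → ℕ) i → f i ≤ sum f
term≤sum f zero = m≤m+n (f zero) (sum (f ∘ suc))
term≤sum f (suc i) = ≤-trans (term≤sum (f ∘ suc) i) (m≤n+m (sum (f ∘ suc)) (f zero))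

∣-sum : ∀ {d k} (f : Fin k → ℕ) → (∀ i → d ∣ f i) → d ∣ sum f
∣-sum {d} {zero} f _ = d ∣0
∣-sum {k = suc k} f d∣f = ∣m∣n⇒∣m+n (d∣f zero) (∣-sum (f ∘ suc) (d∣f ∘ suc))

sum-single : ∀ {k} (f : Fin k → ℕ) c → (∀ i → i ≢ c → f i ≡ 0) → sum f ≡ f c
sum-single {suc k} f zero others≡0 = begin
  f zero + sum (f ∘ suc)             ≡⟨ cong (f zero +_) (sum-cong-≗ (λ i → others≡0 (suc i) λ ())) ⟩
  f zero + sum (replicate k 0)       ≡⟨ cong (f zero +_) (sum-replicate-zero k) ⟩
  f zero + 0                         ≡⟨ +-identityʳ (f zero) ⟩
  f zero                             ∎
  where open ≡-Reasoning
sum-single {suc k} f (suc c) others≡0 =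
  cong₂ _+_ (others≡0 zero λ ()) (sum-single (f ∘ suc) c (λ i i≢c → others≡0 (suc i) (i≢c ∘ Finₚ.suc-injective)))

sum>0⇒∃term>0 : ∀ {k} (f : Fin k → ℕ) → 0 < sum f → ∃ λ i → 0 < f i
sum>0⇒∃term>0 {suc k} f 0<sum with f zero in f0≡
... | suc _ = zero , subst (0 <_) (sym f0≡) z<s
... | zero with sum>0⇒∃term>0 (f ∘ suc) 0<sum
...   | i , 0<fi = suc i , 0<fi

prefixSum : (ℕ → ℕ) → ℕ → ℕ
prefixSum ω zero = 0
prefixSum ω (suc t) = prefixSum ω t + ω t

prefixSum-mono-≤ : ∀ ω {s t} → s ≤ t → prefixSum ω s ≤ prefixSum ω t
prefixSum-mono-≤ ω {t = zero} z≤n = ≤-refl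
prefixSum-mono-≤ ω {s} {suc t} s≤1+t with m≤n⇒m<n∨m≡n s≤1+t
... | inj₁ (s≤s s≤t) = ≤-trans (prefixSum-mono-≤ ω s≤t) (m≤m+n (prefixSum ω t) (ω t))
... | inj₂ refl = ≤-refl

∣-prefixSum : ∀ {d} ω t → (∀ i → i < t → d ∣ ω i) → d ∣ prefixSum ω t
∣-prefixSum {d} ω zero _ = d ∣0
∣-prefixSum ω (suc t) d∣ω = ∣m∣n⇒∣m+n (∣-prefixSum ω t (λ i i<t → d∣ω i (m<n⇒m<1+n i<t))) (d∣ω t (n<1+n t))

prefixSum-tiling : ∀ ω t v → v < prefixSum ω t →
                   ∃ λ i → i < t × v ∈[ prefixSum ω i , prefixSum ω i + ω i ⟩
prefixSum-tiling ω (suc t) v v<sum with v <? prefixSum ω t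
... | no v≮sumₜ = t , n<1+n t , ≮⇒≥ v≮sumₜ , v<sum
... | yes v<sumₜ with prefixSum-tiling ω t v v<sumₜ
...   | i , i<t , v∈ = i , m<n⇒m<1+n i<t , v∈

below : ℕ → ℕ → ℕ → ℕ
below k zero x = 0
below zero (suc t) x = x
below (suc k) (suc t) x = below k t x

at : ℕ → ℕ → ℕ → ℕ
at zero zero x = x
at zero (suc t) x = 0
at (suc k) zero x = 0
at (suc k) (suc t) x = at k t x

below-suc : ∀ k t x → below k (suc t) x ≡ below k t x + at k t x
below-suc zero zero x = refl
below-suc zero (suc t) x = sym (+-identityʳ x)
below-suc (suc k) zero x = refl
below-suc (suc k) (suc t) x = below-suc k t x

below≤ : ∀ k t x → below k t x ≤ x
below≤ k zero x = z≤n
below≤ zero (suc t) x = ≤-refl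
below≤ (suc k) (suc t) x = below≤ k t x

at-self : ∀ k x → at k k x ≡ x
at-self zero x = refl
at-self (suc k) x = at-self k x

at-≢ : ∀ {k t} x → k ≢ t → at k t x ≡ 0
at-≢ {zero} {zero} x k≢t = ⊥-elim (k≢t refl)
at-≢ {zero} {suc t} x _ = refl
at-≢ {suc k} {zero} x _ = refl
at-≢ {suc k} {suc t} x k≢t = at-≢ x (k≢t ∘ cong suc)

at>0⇒≡ : ∀ k t x → 0 < at k t x → k ≡ t
at>0⇒≡ zero zero x _ = refl
at>0⇒≡ (suc k) (suc t) x 0<at = cong suc (at>0⇒≡ k t x 0<at)

∣-at : ∀ {d} k t x → (k ≡ t → d ∣ x) → d ∣ at k t x
∣-at zero zero x d∣x = d∣x refl
∣-at {d} zero (suc t) x _ = d ∣0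
∣-at {d} (suc k) zero x _ = d ∣0
∣-at (suc k) (suc t) x d∣x = ∣-at k t x (d∣x ∘ cong suc)

m*n+i<o*n+j : ∀ {m n o} i j → i < n → m < o → m * n + i < o * n + j
m*n+i<o*n+j {m} {n} {o} i j i<n m<o = begin-strict
  m * n + i   <⟨ +-monoʳ-< (m * n) i<n ⟩
  m * n + n   ≡⟨ +-comm (m * n) n ⟩
  suc m * n   ≤⟨ *-monoˡ-≤ n m<o ⟩
  o * n       ≤⟨ m≤m+n (o * n) j ⟩
  o * n + j   ∎
  where open ≤-Reasoning

-- weight m k is 2^m · 2^-k, except that length 0 (an unused symbol) weighs nothing.
weight : ℕ → ℕ → ℕ
weight m zero = 0
weight m (suc k) = 2 ^ (m ∸ suc k)

weight-≢0 : ∀ m {k} → k ≢ 0 → weight m k ≡ 2 ^ (m ∸ k)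
weight-≢0 m {zero} k≢0 = ⊥-elim (k≢0 refl)
weight-≢0 m {suc k} _ = refl

weight>0⇒≢0 : ∀ m {k} → 0 < weight m k → k ≢ 0
weight>0⇒≢0 m {suc k} _ ()

weight>0 : ∀ m {k} → k ≢ 0 → 0 < weight m k
weight>0 m {k} k≢0 = subst (0 <_) (sym (weight-≢0 m k≢0)) (m^n>0 2 (m ∸ k))

2^[m∸j]∣weight : ∀ m {j k} → k ≤ j → 2 ^ (m ∸ j) ∣ weight m k
2^[m∸j]∣weight m {k = zero} _ = _ ∣0
2^[m∸j]∣weight m {k = suc k} k≤j = ^-monoʳ-∣ 2 (∸-monoʳ-≤ m k≤j)

-- dyadic a m is a / 2^m (mkℚᵘ stores the denominator minus one).
dyadic : ℕ → ℕ → ℚᵘ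
dyadic a m = mkℚᵘ (pos a) (2 ^ m ∸ 1)

1+[2^m∸1]≡2^m : ∀ m → suc (2 ^ m ∸ 1) ≡ 2 ^ m
1+[2^m∸1]≡2^m m = m+[n∸m]≡n (m^n>0 2 m)

mkℚᵘ-+-sameDenominator : ∀ a b d → mkℚᵘ (pos a) d ℚᵘ.+ mkℚᵘ (pos b) d ≃ᵘ mkℚᵘ (pos (a + b)) d
mkℚᵘ-+-sameDenominator a b d = *≡* (begin
  (pos a ℤ.* pos D ℤ.+ pos b ℤ.* pos D) ℤ.* pos D
    ≡⟨ cong₂ (λ x y → (x ℤ.+ y) ℤ.* pos D) (ℤ.pos-* a D) (ℤ.pos-* b D) ⟨
  (pos (a * D) ℤ.+ pos (b * D)) ℤ.* pos D  ≡⟨ cong (ℤ._* pos D) (ℤ.pos-+ (a * D) (b * D)) ⟨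
  pos (a * D + b * D) ℤ.* pos D            ≡⟨ ℤ.pos-* (a * D + b * D) D ⟨
  pos ((a * D + b * D) * D)                ≡⟨ cong (λ x → pos (x * D)) (*-distribʳ-+ D a b) ⟨
  pos ((a + b) * D * D)                    ≡⟨ cong pos (*-assoc (a + b) D D) ⟩
  pos ((a + b) * (D * D))                  ≡⟨ ℤ.pos-* (a + b) (D * D) ⟩
  pos (a + b) ℤ.* pos (D * D)              ∎)
  where
  open ≡-Reasoning
  D = suc d

1/[1+d]≃c/[1+e] : ∀ c d e → suc d * c ≡ suc e → mkℚᵘ (pos 1) d ≃ᵘ mkℚᵘ (pos c) e
1/[1+d]≃c/[1+e] c d e [1+d]c≡1+e = *≡* (begin
  pos 1 ℤ.* pos (suc e)  ≡⟨ ℤ.*-identityˡ (pos (suc e)) ⟩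
  pos (suc e)            ≡⟨ cong pos (trans (sym [1+d]c≡1+e) (*-comm (suc d) c)) ⟩
  pos (c * suc d)        ≡⟨ ℤ.pos-* c (suc d) ⟩
  pos c ℤ.* pos (suc d)  ∎)
  where open ≡-Reasoning

toℚᵘ-/ : ∀ a d .{{_ : ℕ.NonZero d}} → toℚᵘ (pos a ℚ./ d) ≃ᵘ mkℚᵘ (pos a) (d ∸ 1)
toℚᵘ-/ a (suc d) = ℚ.toℚᵘ-fromℚᵘ (mkℚᵘ (pos a) d)

toℚᵘ-2^- : ∀ {k m} → k ≤ m → toℚᵘ (2^- k) ≃ᵘ dyadic (2 ^ (m ∸ k)) m
toℚᵘ-2^- {k} {m} k≤m = ℚᵘ.≃-trans (toℚᵘ-/ 1 (2 ^ k) {{m^n≢0 2 k}})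
  (1/[1+d]≃c/[1+e] (2 ^ (m ∸ k)) (2 ^ k ∸ 1) (2 ^ m ∸ 1) (begin
    suc (2 ^ k ∸ 1) * 2 ^ (m ∸ k) ≡⟨ cong (_* 2 ^ (m ∸ k)) (1+[2^m∸1]≡2^m k) ⟩
    2 ^ k * 2 ^ (m ∸ k)           ≡⟨ ^-distribˡ-+-* 2 k (m ∸ k) ⟨
    2 ^ (k + (m ∸ k))             ≡⟨ cong (2 ^_) (m+[n∸m]≡n k≤m) ⟩
    2 ^ m                         ≡⟨ 1+[2^m∸1]≡2^m m ⟨
    suc (2 ^ m ∸ 1)               ∎))
  where open ≡-Reasoning

-- kraftSum l is kraftSumOf l (allFin n), and allFin n = tabulate id.
kraftSumOf : ∀ {n} → (Fin n → ℕ) → List (Fin n) → ℚ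
kraftSumOf l cs = foldr ℚ._+_ 0ℚ (map (λ i → 2^- l i) (filter (λ i → ¬? (l i ℕ.≟ 0)) cs))

kraftSumOf-tabulate : ∀ {n} (l : Fin n → ℕ) m → (∀ c → l c ≤ m) → ∀ {k} (g : Fin k → Fin n) →
  toℚᵘ (kraftSumOf l (tabulate g)) ≃ᵘ dyadic (sum (λ i → weight m (l (g i)))) m
kraftSumOf-tabulate l m l≤m {zero} g = *≡* refl
kraftSumOf-tabulate l m l≤m {suc k} g with l (g Fin.zero) ℕ.≟ 0
... | yes l≡0 = begin
  toℚᵘ (kraftSumOf l (c ∷ cs))           ≡⟨ cong (toℚᵘ ∘ foldr ℚ._+_ 0ℚ ∘ map (λ i → 2^- l i))
                                                  (filter-reject (λ i → ¬? (l i ℕ.≟ 0)) (λ l≢0 → l≢0 l≡0)) ⟩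
  toℚᵘ (kraftSumOf l cs)                 ≈⟨ kraftSumOf-tabulate l m l≤m (g ∘ Fin.suc) ⟩
  dyadic restWeight m                    ≡⟨ cong (λ x → dyadic (weight m x + restWeight) m) l≡0 ⟨
  dyadic (weight m (l c) + restWeight) m ∎
  where
  open ℚᵘ.≃-Reasoning
  c = g Fin.zero
  cs = tabulate (g ∘ Fin.suc)
  restWeight = sum (λ i → weight m (l (g (Fin.suc i))))
... | no l≢0 = begin
  toℚᵘ (kraftSumOf l (c ∷ cs))                       ≡⟨ cong (toℚᵘ ∘ foldr ℚ._+_ 0ℚ ∘ map (λ i → 2^- l i))
                                                          (filter-accept (λ i → ¬? (l i ℕ.≟ 0)) l≢0) ⟩
  toℚᵘ (2^- l c ℚ.+ kraftSumOf l cs)                 ≈⟨ ℚ.toℚᵘ-homo-+ (2^- l c) (kraftSumOf l cs) ⟩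
  toℚᵘ (2^- l c) ℚᵘ.+ toℚᵘ (kraftSumOf l cs)         ≈⟨ ℚᵘ.+-cong (toℚᵘ-2^- (l≤m c)) (kraftSumOf-tabulate l m l≤m (g ∘ Fin.suc)) ⟩
  dyadic (2 ^ (m ∸ l c)) m ℚᵘ.+ dyadic restWeight m  ≈⟨ mkℚᵘ-+-sameDenominator (2 ^ (m ∸ l c)) restWeight (2 ^ m ∸ 1) ⟩
  dyadic (2 ^ (m ∸ l c) + restWeight) m              ≡⟨ cong (λ x → dyadic (x + restWeight) m) (weight-≢0 m l≢0) ⟨
  dyadic (weight m (l c) + restWeight) m             ∎
  where
  open ℚᵘ.≃-Reasoning
  c = g Fin.zero
  cs = tabulate (g ∘ Fin.suc)
  restWeight = sum (λ i → weight m (l (g (Fin.suc i))))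

dyadic≤1⇒≤2^m : ∀ a m → dyadic a m ℚᵘ.≤ ℚᵘ.1ℚᵘ → a ≤ 2 ^ m
dyadic≤1⇒≤2^m a m (*≤* a*1≤1*2^m) = subst (a ≤_) (1+[2^m∸1]≡2^m m)
  (ℤ.drop‿+≤+ (subst₂ ℤ._≤_ (ℤ.*-identityʳ (pos a)) (ℤ.*-identityˡ (pos (suc (2 ^ m ∸ 1)))) a*1≤1*2^m))

kraftSum≤1⇒∑weight≤2^m : ∀ {n} (l : Fin n → ℕ) m → (∀ c → l c ≤ m) → kraftSum l ℚ.≤ 1ℚ →
                         sum (λ c → weight m (l c)) ≤ 2 ^ m
kraftSum≤1⇒∑weight≤2^m l m l≤m kraft≤1 = dyadic≤1⇒≤2^m _ m
  (ℚᵘ.≤-respˡ-≃ (kraftSumOf-tabulate l m l≤m id) (ℚ.toℚᵘ-mono-≤ kraft≤1))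

module CanonicalCode {n : ℕ} (l : Fin n → ℕ) where

  -- Any common bound on the lengths serves as the numeral width.
  M : ℕ
  M = sum l

  l≤M : ∀ c → l c ≤ M
  l≤M = term≤sum l

  w : Fin n → ℕ
  w c = weight M (l c)

  -- key c encodes the pair (l c , c): comparing keys compares lengths first
  -- and indices second, the order in which the blocks are laid out.
  key : Fin n → ℕ
  key c = l c * n + toℕ c

  key-mono-< : ∀ a b → l a < l b → key a < key b
  key-mono-< a b = m*n+i<o*n+j (toℕ a) (toℕ b) (Finₚ.toℕ<n a)

  key-mono-≤ : ∀ a b → l a ≡ l b → a Fin.≤ b → key a ≤ key b
  key-mono-≤ a b la≡lb a≤b rewrite la≡lb = +-monoʳ-≤ (l b * n) a≤b

  key≤⇒l≤ : ∀ a b → key a ≤ key b → l a ≤ l b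
  key≤⇒l≤ a b ka≤kb = ≮⇒≥ (λ lb<la → <⇒≱ (key-mono-< b a lb<la) ka≤kb)

  key-injective : ∀ a b → key a ≡ key b → a ≡ b
  key-injective a b ka≡kb = Finₚ.toℕ-injective (+-cancelˡ-≡ (l b * n) (toℕ a) (toℕ b) (begin
    l b * n + toℕ a ≡⟨ cong (λ x → x * n + toℕ a) la≡lb ⟨
    key a           ≡⟨ ka≡kb ⟩
    key b           ∎))
    where
    open ≡-Reasoning
    la≡lb : l a ≡ l b
    la≡lb = ≤-antisym (key≤⇒l≤ a b (≤-reflexive ka≡kb)) (key≤⇒l≤ b a (≤-reflexive (sym ka≡kb)))

  weightAt : ℕ → ℕ
  weightAt t = sum (λ c → at (key c) t (w c))

  offset : Fin n → ℕ
  offset a = prefixSum weightAt (key a)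

  weightAt-key : ∀ a → weightAt (key a) ≡ w a
  weightAt-key a = trans (sum-single _ a (λ c c≢a → at-≢ (w c) (c≢a ∘ key-injective c a)))
                         (at-self (key a) (w a))

  weightAt>0⇒key : ∀ t → 0 < weightAt t → ∃ λ c → key c ≡ t
  weightAt>0⇒key t 0<weight with sum>0⇒∃term>0 _ 0<weight
  ... | c , 0<at = c , at>0⇒≡ (key c) t (w c) 0<at

  offset+w≡prefixSum : ∀ a → offset a + w a ≡ prefixSum weightAt (suc (key a))
  offset+w≡prefixSum a = cong (offset a +_) (sym (weightAt-key a))

  prefixSum≡sum-below : ∀ t → prefixSum weightAt t ≡ sum (λ c → below (key c) t (w c))
  prefixSum≡sum-below zero = sym (sum-replicate-zero n)
  prefixSum≡sum-below (suc t) = begin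
    prefixSum weightAt t + weightAt t
      ≡⟨ cong (_+ weightAt t) (prefixSum≡sum-below t) ⟩
    sum (λ c → below (key c) t (w c)) + weightAt t
      ≡⟨ ∑-distrib-+ (λ c → below (key c) t (w c)) (λ c → at (key c) t (w c)) ⟨
    sum (λ c → below (key c) t (w c) + at (key c) t (w c))
      ≡⟨ sum-cong-≗ (λ c → below-suc (key c) t (w c)) ⟨
    sum (λ c → below (key c) (suc t) (w c))
      ∎
    where open ≡-Reasoning

  prefixSum≤sum-w : ∀ t → prefixSum weightAt t ≤ sum w
  prefixSum≤sum-w t = subst (_≤ sum w) (sym (prefixSum≡sum-below t)) (sum-mono-≤ (λ c → below≤ (key c) t (w c)))

  offset+w≤offset : ∀ a b → key a < key b → offset a + w a ≤ offset b
  offset+w≤offset a b ka<kb = subst (_≤ offset b) (sym (offset+w≡prefixSum a)) (prefixSum-mono-≤ weightAt ka<kb)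

  offset-mono : ∀ a b → key a ≤ key b → offset a ≤ offset b
  offset-mono a b = prefixSum-mono-≤ weightAt

  2^[M∸l]∣offset : ∀ a → 2 ^ (M ∸ l a) ∣ offset a
  2^[M∸l]∣offset a = ∣-prefixSum weightAt (key a) λ i i<ka → ∣-sum _ λ c →
    ∣-at (key c) i (w c) λ kc≡i → 2^[m∸j]∣weight M (key≤⇒l≤ c a (<⇒≤ (subst (_< key a) (sym kc≡i) i<ka)))

  offset∈block⇒≡ : ∀ a b → 0 < w b → offset b ∈[ offset a , offset a + w a ⟩ → a ≡ b
  offset∈block⇒≡ a b 0<wb (sa≤sb , sb<sa+wa) with <-cmp (key a) (key b)
  ... | tri< ka<kb _ _ = ⊥-elim (<⇒≱ sb<sa+wa (offset+w≤offset a b ka<kb))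
  ... | tri≈ _ ka≡kb _ = key-injective a b ka≡kb
  ... | tri> _ _ kb<ka = ⊥-elim (<⇒≱ (m<m+n (offset b) 0<wb) (≤-trans (offset+w≤offset b a kb<ka) sa≤sb))

  block-tiling : ∀ a v → v < offset a + w a → ∃ λ b → key b ≤ key a × v ∈[ offset b , offset b + w b ⟩
  block-tiling a v v<end with prefixSum-tiling weightAt (suc (key a)) v (subst (v <_) (offset+w≡prefixSum a) v<end)
  ... | i , i<1+ka , v∈ with weightAt>0⇒key i (∈[s,s+x⟩⇒0<x v∈)
  ... | b , refl = b , s≤s⁻¹ i<1+ka , subst (λ x → v ∈[ offset b , offset b + x ⟩) (weightAt-key b) v∈

  code : Fin n → List Bit
  code a = leadingBits (l a) M (offset a)

  length-code : ∀ a → length (code a) ≡ l a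
  length-code a = length-leadingBits (l a) M (offset a)

  length-code≤M : ∀ a → length (code a) ≤ M
  length-code≤M a = subst (_≤ M) (sym (length-code a)) (l≤M a)

  l≡0⇒code≡[] : ∀ a → l a ≡ 0 → code a ≡ []
  l≡0⇒code≡[] a la≡0 = cong (λ k → leadingBits k M (offset a)) la≡0

  l≢0⇒code≢[] : ∀ a → l a ≢ 0 → code a ≢ []
  l≢0⇒code≢[] a la≢0 code≡[] = la≢0 (trans (sym (length-code a)) (cong length code≡[]))

  2^[M∸length]-code : ∀ a → l a ≢ 0 → 2 ^ (M ∸ length (code a)) ≡ w a
  2^[M∸length]-code a la≢0 = trans (cong (λ k → 2 ^ (M ∸ k)) (length-code a)) (sym (weight-≢0 M la≢0))

  module _ (kraft : sum w ≤ 2 ^ M) where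

    value-code : ∀ a → l a ≢ 0 → value M (code a) ≡ offset a
    value-code a la≢0 = value-leadingBits (l a) M (offset a) (l≤M a) offset<2^M (2^[M∸l]∣offset a)
      where
      offset<2^M : offset a < 2 ^ M
      offset<2^M = begin-strict
        offset a                          <⟨ m<m+n (offset a) (weight>0 M la≢0) ⟩
        offset a + w a                    ≡⟨ offset+w≡prefixSum a ⟩
        prefixSum weightAt (suc (key a))  ≤⟨ prefixSum≤sum-w (suc (key a)) ⟩
        sum w                             ≤⟨ kraft ⟩
        2 ^ M                             ∎
        where open ≤-Reasoning

    value-code-mono : ∀ a b → key a ≤ key b → value M (code a) ≤ value M (code b)
    value-code-mono a b ka≤kb with l a ≟ 0
    ... | yes la≡0 = subst (λ u → value M u ≤ value M (code b)) (sym (l≡0⇒code≡[] a la≡0)) z≤n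
    ... | no la≢0 = subst₂ _≤_ (sym (value-code a la≢0)) (sym (value-code b lb≢0)) (offset-mono a b ka≤kb)
      where
      lb≢0 : l b ≢ 0
      lb≢0 lb≡0 = la≢0 (n≤0⇒n≡0 (subst (l a ≤_) lb≡0 (key≤⇒l≤ a b ka≤kb)))

    prefixFree : ∀ a b → a ≢ b → code a ≢ [] → ¬ (code a ≼ code b)
    prefixFree a b a≢b codea≢[] codea≼codeb@(c , codea++c≡codeb) =
      a≢b (offset∈block⇒≡ a b (weight>0 M lb≢0) offsetb∈blocka)
      where
      la≢0 : l a ≢ 0
      la≢0 = codea≢[] ∘ l≡0⇒code≡[] a
      lb≢0 : l b ≢ 0
      lb≢0 = codea≢[] ∘ ++-conicalˡ (code a) c ∘ trans codea++c≡codeb ∘ l≡0⇒code≡[] b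
      offsetb∈blocka : offset b ∈[ offset a , offset a + w a ⟩
      offsetb∈blocka = subst₂ (λ s x → offset b ∈[ s , s + x ⟩) (value-code a la≢0) (2^[M∸length]-code a la≢0)
        (subst (_∈[ _ , _ ⟩) (value-code b lb≢0) (≼⇒value-∈ M (code a) (code b) codea≼codeb (length-code≤M b)))

    shorterFirst : ∀ a b → length (code a) < length (code b) → code a ⊑ code b
    shorterFirst a b |ca|<|cb| = value-≤⇒⊑ M (code a) (code b) (<⇒≤ |ca|<|cb|) (length-code≤M b)
      (value-code-mono a b (<⇒≤ (key-mono-< a b (subst₂ _<_ (length-code a) (length-code b) |ca|<|cb|))))

    sameLenOrdered : ∀ a b → length (code a) ≡ length (code b) → a Fin.≤ b → code a ⊑ code b
    sameLenOrdered a b |ca|≡|cb| a≤b = value-≤⇒⊑ M (code a) (code b) (≤-reflexive |ca|≡|cb|) (length-code≤M b)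
      (value-code-mono a b (key-mono-≤ a b (trans (sym (length-code a)) (trans |ca|≡|cb| (length-code b))) a≤b))

    noGaps : ∀ a p → p ≢ [] → p ⊑ code a → length p ≡ length (code a) →
             ∃ λ b → code b ≢ [] × code b ≼ p
    noGaps a [] []≢[] _ _ = ⊥-elim ([]≢[] refl)
    noGaps a p@(_ ∷ _) _ p⊑ca |p|≡|ca| = prefixOfP (block-tiling a (value M p) valuep<end)
      where
      |p|≡la : length p ≡ l a
      |p|≡la = trans |p|≡|ca| (length-code a)
      la≢0 : l a ≢ 0
      la≢0 la≡0 = 1+n≢0 (trans |p|≡la la≡0)
      |p|≤M : length p ≤ M
      |p|≤M = subst (_≤ M) (sym |p|≡la) (l≤M a)
      valuep<end : value M p < offset a + w a
      valuep<end = begin-strict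
        value M p         ≤⟨ ⊑⇒value-≤ M p (code a) p⊑ca |p|≤M (length-code≤M a) ⟩
        value M (code a)  ≡⟨ value-code a la≢0 ⟩
        offset a          <⟨ m<m+n (offset a) (weight>0 M la≢0) ⟩
        offset a + w a    ∎
        where open ≤-Reasoning
      prefixOfP : (∃ λ b → key b ≤ key a × value M p ∈[ offset b , offset b + w b ⟩) →
                  ∃ λ b → code b ≢ [] × code b ≼ p
      prefixOfP (b , kb≤ka , valuep∈) = b , l≢0⇒code≢[] b lb≢0 , value-∈⇒≼ M (code b) p |cb|≤|p| |p|≤M
        (subst₂ (λ s x → value M p ∈[ s , s + x ⟩) (sym (value-code b lb≢0)) (sym (2^[M∸length]-code b lb≢0)) valuep∈)
        where
        lb≢0 : l b ≢ 0
        lb≢0 = weight>0⇒≢0 M (∈[s,s+x⟩⇒0<x valuep∈)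
        |cb|≤|p| : length (code b) ≤ length p
        |cb|≤|p| = subst₂ _≤_ (sym (length-code b)) (sym |p|≡la) (key≤⇒l≤ b a kb≤ka)

    isDeflateCoding : IsDeflateCoding code
    isDeflateCoding = record
      { prefixFree = prefixFree
      ; shorterFirst = shorterFirst
      ; sameLenOrdered = sameLenOrdered
      ; noGaps = noGaps
      }

theorem3 : (n : ℕ) (l : Fin n → ℕ) → kraftSum l ℚ.≤ 1ℚ →
    Σ (Fin n → List Bit) (λ code → IsDeflateCoding code × (∀ x → l x ≡ length (code x)))
theorem3 n l kraft≤1 = code , isDeflateCoding kraft , λ x → sym (length-code x)
  where
  open CanonicalCode l
  kraft : sum w ≤ 2 ^ M
  kraft = kraftSum≤1⇒∑weight≤2^m l M l≤M kraft≤1
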